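{- Let $\Sigma_4=\{0,1,2,3\}$. There exists an infinite word over $\Sigma_4$ that is squarefree and contains no occurrence of any of the subwords $12$, $13$, $21$, $32$, $231$, $10302$.
   Context: A square is a nonempty word of the form $xx$. A (finite or infinite) word is squarefree if it contains no square as a (contiguous) subword. -}

module Defs where

open import Data.Nat using (ℕ; zero; suc; _+_; _<_)
open import Data.Fin using (Fin)
open import Data.List using (List; []; _∷_; length; lookup)
open import Data.Product using (∃; ∃-syntax; _×_)
open import Relation.Binary.PropositionalEquality using (_≡_)
open import Relation.Nullary using (¬_)

Σ₄ : Set
Σ₄ = Fin 4

a0 a1 a2 a3 : Σ₄
a0 = Data.Fin.zero
a1 = Data.Fin.suc Data.Fin.zero
a2 = Data.Fin.suc (Data.Fin.suc Data.Fin.zero)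
a3 = Data.Fin.suc (Data.Fin.suc (Data.Fin.suc Data.Fin.zero))

InfWord : Set → Set
InfWord A = ℕ → A

OccursAt : {A : Set} → List A → InfWord A → ℕ → Set
OccursAt u w i = (k : Fin (length u)) → w (i + Data.Fin.toℕ k) ≡ lookup u k

Occurs : {A : Set} → List A → InfWord A → Set
Occurs u w = ∃[ i ] OccursAt u w i

SquareAt : {A : Set} → InfWord A → ℕ → ℕ → Set
SquareAt w i n = (k : ℕ) → k < n → w (i + k) ≡ w (i + n + k)

Squarefree : {A : Set} → InfWord A → Set
Squarefree w = ¬ (∃[ i ] ∃[ n ] (0 < n × SquareAt w i n))

forbidden : List (List Σ₄)
forbidden = (a1 ∷ a2 ∷ []) ∷ (a1 ∷ a3 ∷ []) ∷ (a2 ∷ a1 ∷ []) ∷ (a3 ∷ a2 ∷ [])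
          ∷ (a2 ∷ a3 ∷ a1 ∷ []) ∷ (a1 ∷ a0 ∷ a3 ∷ a0 ∷ a2 ∷ []) ∷ []

-- The word is the fixed point φ^ω(0) of a 7-uniform morphism φ. Its length-4 factors all lie in a
-- 17-element set closed under taking length-4 factors of φ-images, and a factor of length at most 22
-- starting at position i is read off the φ-image of the length-4 factor at position ⌊i/7⌋. Absence of
-- the forbidden words and of squares of period below 12, as well as synchronization (equal length-12
-- factors start at positions congruent mod 7), thus become finite checks. So a square of period at
-- least 12 has period 7n; as column 3 of φ is injective, reading that column desubstitutes it into a
-- square of period n, and descent on the period excludes all squares.
module Submission where

open import Defs
open import Data.Nat using (ℕ; zero; suc; z<s; _+_; _*_; _≤_; _<_; z≤n; s≤s; NonZero; pred; _/_; _%_; _≟_; _<?_; _≤?_)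
open import Data.Nat.Properties
open import Data.Nat.DivMod
open import Data.Nat.Divisibility using (_∣_; divides; divides-refl; n∣m*n; ∣m+n∣m⇒∣n)
open import Data.Nat.Induction using (<-rec)
open import Data.Nat.Tactic.RingSolver using (solve-∀)
open import Data.Fin using (Fin; toℕ; #_)
import Data.Fin as Fin
open import Data.Fin.Properties using (toℕ-injective; toℕ-fromℕ<; toℕ<n) renaming (all? to allFin?)
open import Data.List using (List; []; _∷_; _++_; length; take; drop; concatMap; tabulate)
import Data.List.Properties as List
open import Data.List.Membership.Propositional using (_∈_)
import Data.List.Membership.DecPropositional as DecMembership
open import Data.List.Relation.Unary.All as All using (All; all?)
open import Data.Vec using (Vec; []; _∷_; lookup)
open import Data.Product using (∃-syntax; _×_; _,_; proj₁; proj₂)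
open import Data.Empty using (⊥-elim)
open import Relation.Nullary using (¬_; ¬?; yes; no)
open import Relation.Nullary.Decidable using (from-yes; _→-dec_; _×-dec_)
open import Relation.Binary.Definitions using (DecidableEquality)
open import Relation.Binary.PropositionalEquality
open import Function.Definitions using (Injective)

module _ {A : Set} where

  factor : InfWord A → ℕ → ℕ → List A
  factor w i zero    = []
  factor w i (suc n) = w i ∷ factor w (suc i) n

  slice : ℕ → ℕ → List A → List A
  slice r n xs = take n (drop r xs)

  factor-++ : ∀ (w : InfWord A) i a b → factor w i (a + b) ≡ factor w i a ++ factor w (i + a) b
  factor-++ w i zero    b = cong (λ j → factor w j b) (sym (+-identityʳ i))
  factor-++ w i (suc a) b =
    cong (w i ∷_) (trans (factor-++ w (suc i) a b)
                         (cong (λ j → factor w (suc i) a ++ factor w j b) (sym (+-suc i a))))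

  factor-tabulate : ∀ (w : InfWord A) i n → factor w i n ≡ tabulate (λ (k : Fin n) → w (i + toℕ k))
  factor-tabulate w i zero    = refl
  factor-tabulate w i (suc n) =
    cong₂ _∷_ (cong w (sym (+-identityʳ i)))
              (trans (factor-tabulate w (suc i) n) (List.tabulate-cong λ k → cong w (sym (+-suc i (toℕ k)))))

  take-factor : ∀ (w : InfWord A) i n N → n ≤ N → take n (factor w i N) ≡ factor w i n
  take-factor w i zero    N       _         = refl
  take-factor w i (suc n) (suc N) (s≤s n≤N) = cong (w i ∷_) (take-factor w (suc i) n N n≤N)

  slice-factor : ∀ (w : InfWord A) i r n N → r + n ≤ N → slice r n (factor w i N) ≡ factor w (i + r) n
  slice-factor w i zero    n N       n≤N         =
    trans (take-factor w i n N n≤N) (cong (λ j → factor w j n) (sym (+-identityʳ i)))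
  slice-factor w i (suc r) n (suc N) (s≤s r+n≤N) =
    trans (slice-factor w (suc i) r n N r+n≤N) (cong (λ j → factor w j n) (sym (+-suc i r)))

  factor-cong : ∀ (w : InfWord A) i j n → (∀ k → k < n → w (i + k) ≡ w (j + k)) → factor w i n ≡ factor w j n
  factor-cong w i j zero    _  = refl
  factor-cong w i j (suc n) eq =
    cong₂ _∷_ (trans (cong w (sym (+-identityʳ i))) (trans (eq 0 (s≤s z≤n)) (cong w (+-identityʳ j))))
              (factor-cong w (suc i) (suc j) n λ k k<n →
                 trans (cong w (sym (+-suc i k))) (trans (eq (suc k) (s≤s k<n)) (cong w (+-suc j k))))

  square-factor : ∀ {w : InfWord A} {i n} → SquareAt w i n → ∀ L → L ≤ n → factor w i L ≡ factor w (i + n) L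
  square-factor sq L L≤n = factor-cong _ _ _ L λ k k<L → sq k (<-≤-trans k<L L≤n)

  occurs-factor : ∀ {w : InfWord A} {i} (u : List A) → OccursAt u w i → factor w i (length u) ≡ u
  occurs-factor {w} {i} u occ =
    trans (factor-tabulate w i (length u)) (trans (List.tabulate-cong occ) (List.tabulate-lookup u))

m%d≡[m+n]%d⇒d∣n : ∀ m n d .{{_ : NonZero d}} → m % d ≡ (m + n) % d → d ∣ n
m%d≡[m+n]%d⇒d∣n m n d eq = ∣m+n∣m⇒∣n (divides ((m + n) / d) quotients) (n∣m*n (m / d))
  where
  open ≡-Reasoning
  quotients : m / d * d + n ≡ (m + n) / d * d
  quotients = +-cancelˡ-≡ (m % d) _ _ (begin
    m % d + (m / d * d + n)       ≡⟨ +-assoc (m % d) _ n ⟨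
    m % d + m / d * d + n         ≡⟨ cong (_+ n) (m≡m%n+[m/n]*n m d) ⟨
    m + n                         ≡⟨ m≡m%n+[m/n]*n (m + n) d ⟩
    (m + n) % d + (m + n) / d * d  ≡⟨ cong (_+ (m + n) / d * d) eq ⟨
    m % d + (m + n) / d * d       ∎)

module FixedPoint {A : Set} (m : ℕ) .{{_ : NonZero m}} (1<m : 1 < m)
                  (h : A → Fin m → A) (a : A) (prolongable : h a (0 mod m) ≡ a) where

  private
    -- approx f p is correct for p ≤ f, which makes approx p p a structurally recursive fixed point.
    approx : ℕ → ℕ → A
    approx zero    _ = a
    approx (suc f) p = h (approx f (p / m)) (p mod m)

    approx-0 : ∀ f → approx f 0 ≡ a
    approx-0 zero    = refl
    approx-0 (suc f) = trans (cong (λ p → h (approx f p) (0 mod m)) (0/n≡0 m))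
                             (trans (cong (λ b → h b (0 mod m)) (approx-0 f)) prolongable)

    suc/m≤ : ∀ p → suc p / m ≤ p
    suc/m≤ p = ≤-pred (m/n<m (suc p) m 1<m)

    approx-stable : ∀ f g p → p ≤ f → p ≤ g → approx f p ≡ approx g p
    approx-stable f       g       zero    _         _         = trans (approx-0 f) (sym (approx-0 g))
    approx-stable (suc f) (suc g) (suc p) (s≤s p≤f) (s≤s p≤g) =
      cong (λ b → h b (suc p mod m))
           (approx-stable f g (suc p / m) (≤-trans (suc/m≤ p) p≤f) (≤-trans (suc/m≤ p) p≤g))

  fixedPoint : InfWord A
  fixedPoint p = approx p p

  fixedPoint-unfold : ∀ p → fixedPoint p ≡ h (fixedPoint (p / m)) (p mod m)
  fixedPoint-unfold zero    = sym (trans (cong (λ p → h (approx p p) (0 mod m)) (0/n≡0 m))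
                                         prolongable)
  fixedPoint-unfold (suc p) =
    cong (λ b → h b (suc p mod m)) (approx-stable p (suc p / m) (suc p / m) (suc/m≤ p) ≤-refl)

  block-quotient : ∀ q (j : Fin m) → (q * m + toℕ j) / m ≡ q
  block-quotient q j = begin
    (q * m + toℕ j) / m      ≡⟨ +-distrib-/-∣ˡ (toℕ j) (divides-refl q) ⟩
    q * m / m + toℕ j / m    ≡⟨ cong₂ _+_ (m*n/n≡m q m) (m<n⇒m/n≡0 (toℕ<n j)) ⟩
    q + 0                    ≡⟨ +-identityʳ q ⟩
    q                        ∎
    where open ≡-Reasoning

  block-remainder : ∀ q (j : Fin m) → (q * m + toℕ j) mod m ≡ j
  block-remainder q j = toℕ-injective (begin
    toℕ ((q * m + toℕ j) mod m) ≡⟨ toℕ-fromℕ< _ ⟩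
    (q * m + toℕ j) % m         ≡⟨ cong (_% m) (+-comm (q * m) (toℕ j)) ⟩
    (toℕ j + q * m) % m         ≡⟨ [m+kn]%n≡m%n (toℕ j) q m ⟩
    toℕ j % m                   ≡⟨ m<n⇒m%n≡m (toℕ<n j) ⟩
    toℕ j                       ∎)
    where open ≡-Reasoning

  fixedPoint-block : ∀ q (j : Fin m) → fixedPoint (q * m + toℕ j) ≡ h (fixedPoint q) j
  fixedPoint-block q j =
    trans (fixedPoint-unfold (q * m + toℕ j))
          (cong₂ (λ p → h (fixedPoint p)) (block-quotient q j) (block-remainder q j))

  image : List A → List A
  image = concatMap (λ b → tabulate (h b))

  image-fixedPoint : ∀ q k → image (factor fixedPoint q k) ≡ factor fixedPoint (q * m) (k * m)
  image-fixedPoint q zero    = refl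
  image-fixedPoint q (suc k) = begin
    tabulate (h (fixedPoint q)) ++ image (factor fixedPoint (suc q) k)
      ≡⟨ cong₂ _++_ block (image-fixedPoint (suc q) k) ⟩
    factor fixedPoint (q * m) m ++ factor fixedPoint (m + q * m) (k * m)
      ≡⟨ cong (λ p → factor fixedPoint (q * m) m ++ factor fixedPoint p (k * m)) (+-comm m (q * m)) ⟩
    factor fixedPoint (q * m) m ++ factor fixedPoint (q * m + m) (k * m)
      ≡⟨ factor-++ fixedPoint (q * m) m (k * m) ⟨
    factor fixedPoint (q * m) (m + k * m)
      ∎
    where
    open ≡-Reasoning
    block : tabulate (h (fixedPoint q)) ≡ factor fixedPoint (q * m) m
    block = sym (trans (factor-tabulate fixedPoint (q * m) m) (List.tabulate-cong (fixedPoint-block q)))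

  factor-fixedPoint : ∀ q r n k → r + n ≤ k * m →
                      factor fixedPoint (q * m + r) n ≡ slice r n (image (factor fixedPoint q k))
  factor-fixedPoint q r n k r+n≤ =
    sym (trans (cong (slice r n) (image-fixedPoint q k)) (slice-factor fixedPoint (q * m) r n (k * m) r+n≤))

  aligned : ∀ i (c : Fin m) → ∃[ q ] ∃[ d ] d < m × i + d ≡ q * m + toℕ c
  aligned zero    c = 0 , toℕ c , toℕ<n c , refl
  aligned (suc i) c with aligned i c
  ... | q , suc d , d<m , e = q , d , <-trans (n<1+n d) d<m , trans (sym (+-suc i d)) e
  ... | q , zero  , _   , e = suc q , pred m , m≤pred[n]⇒suc[m]≤n ≤-refl , (begin
    suc i + pred m       ≡⟨ +-suc i (pred m) ⟨
    i + suc (pred m)     ≡⟨ cong₂ _+_ (sym (+-identityʳ i)) (suc-pred m) ⟩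
    i + 0 + m            ≡⟨ cong (_+ m) e ⟩
    q * m + toℕ c + m    ≡⟨ shift q m (toℕ c) ⟩
    suc q * m + toℕ c    ∎)
    where
    open ≡-Reasoning
    shift : ∀ x y z → x * y + z + y ≡ suc x * y + z
    shift = solve-∀

  desubstitute : (c : Fin m) → Injective _≡_ _≡_ (λ x → h x c) →
                 ∀ {i n} → SquareAt fixedPoint i (n * m) → ∃[ q ] SquareAt fixedPoint q n
  desubstitute c injective {i} {n} sq with aligned i c
  ... | q , d , d<m , e = q , λ j j<n → injective (begin
    h (fixedPoint (q + j)) c              ≡⟨ fixedPoint-block (q + j) c ⟨
    fixedPoint ((q + j) * m + toℕ c)      ≡⟨ cong fixedPoint (first-half j) ⟩
    fixedPoint (i + (d + j * m))          ≡⟨ sq (d + j * m) (offset<period j<n) ⟩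
    fixedPoint (i + n * m + (d + j * m))  ≡⟨ cong fixedPoint (second-half j) ⟩
    fixedPoint ((q + n + j) * m + toℕ c)  ≡⟨ fixedPoint-block (q + n + j) c ⟩
    h (fixedPoint (q + n + j)) c          ∎)
    where
    open ≡-Reasoning
    offset<period : ∀ {j} → j < n → d + j * m < n * m
    offset<period {j} j<n = <-≤-trans (+-monoˡ-< (j * m) d<m) (*-monoˡ-≤ m j<n)
    first-half : ∀ j → (q + j) * m + toℕ c ≡ i + (d + j * m)
    first-half j = begin
      (q + j) * m + toℕ c    ≡⟨ regroup q j (toℕ c) m ⟩
      q * m + toℕ c + j * m  ≡⟨ cong (_+ j * m) e ⟨
      i + d + j * m          ≡⟨ +-assoc i d (j * m) ⟩
      i + (d + j * m)        ∎
      where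
      regroup : ∀ x y z k → (x + y) * k + z ≡ x * k + z + y * k
      regroup = solve-∀
    second-half : ∀ j → i + n * m + (d + j * m) ≡ (q + n + j) * m + toℕ c
    second-half j = begin
      i + n * m + (d + j * m)        ≡⟨ regroup i d j n m ⟩
      i + d + (n + j) * m            ≡⟨ cong (_+ (n + j) * m) e ⟩
      q * m + toℕ c + (n + j) * m    ≡⟨ regroup′ q (toℕ c) n j m ⟩
      (q + n + j) * m + toℕ c        ∎
      where
      regroup : ∀ x y z w k → x + w * k + (y + z * k) ≡ x + y + (w + z) * k
      regroup = solve-∀
      regroup′ : ∀ x y w z k → x * k + y + (w + z) * k ≡ (x + w + z) * k + y
      regroup′ = solve-∀

  shorter-square : (c : Fin m) → Injective _≡_ _≡_ (λ x → h x c) →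
                   ∀ {i n} → 0 < n → m ∣ n → SquareAt fixedPoint i n →
                   ∃[ n′ ] 0 < n′ × n′ < n × ∃[ q ] SquareAt fixedPoint q n′
  shorter-square c injective 0<n (divides zero     refl) sq = ⊥-elim (<-irrefl refl 0<n)
  shorter-square c injective {i} _ (divides (suc n′) refl) sq =
    suc n′ , z<s , m<m*n (suc n′) m 1<m , desubstitute c injective {i} {suc n′} sq

  squarefree-by-descent : (c : Fin m) → Injective _≡_ _≡_ (λ x → h x c) → ∀ N →
                          (∀ i n → 0 < n → n < N → ¬ SquareAt fixedPoint i n) →
                          (∀ i n → N ≤ n → SquareAt fixedPoint i n → m ∣ n) →
                          Squarefree fixedPoint
  squarefree-by-descent c injective N short long (i , n , 0<n , sq) = <-rec P step n i 0<n sq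
    where
    P : ℕ → Set
    P n = ∀ i → 0 < n → ¬ SquareAt fixedPoint i n
    step : ∀ n → (∀ {n′} → n′ < n → P n′) → P n
    step n rec i 0<n sq with n <? N
    ... | yes n<N = short i n 0<n n<N sq
    ... | no  n≮N with shorter-square c injective {i} 0<n (long i n (≮⇒≥ n≮N) sq) sq
    ...   | n′ , 0<n′ , n′<n , q , sq′ = rec n′<n q 0<n′ sq′

images : Vec (Vec Σ₄ 7) 4
images = (a0 ∷ a1 ∷ a0 ∷ a3 ∷ a1 ∷ a0 ∷ a2 ∷ [])
       ∷ (a0 ∷ a3 ∷ a0 ∷ a1 ∷ a0 ∷ a2 ∷ a3 ∷ [])
       ∷ (a3 ∷ a0 ∷ a1 ∷ a0 ∷ a2 ∷ a0 ∷ a3 ∷ [])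
       ∷ (a0 ∷ a1 ∷ a0 ∷ a2 ∷ a3 ∷ a0 ∷ a2 ∷ [])
       ∷ []

φ : Σ₄ → Fin 7 → Σ₄
φ a = lookup (lookup images a)

open FixedPoint 7 (s≤s (s≤s z≤n)) φ a0 refl renaming (fixedPoint to word)

factors₄ : List (List Σ₄)
factors₄ =
    (a0 ∷ a1 ∷ a0 ∷ a2 ∷ []) ∷ (a0 ∷ a1 ∷ a0 ∷ a3 ∷ []) ∷ (a0 ∷ a2 ∷ a0 ∷ a1 ∷ []) ∷ (a0 ∷ a2 ∷ a0 ∷ a3 ∷ [])
  ∷ (a0 ∷ a2 ∷ a3 ∷ a0 ∷ []) ∷ (a0 ∷ a3 ∷ a0 ∷ a1 ∷ []) ∷ (a0 ∷ a3 ∷ a1 ∷ a0 ∷ []) ∷ (a1 ∷ a0 ∷ a2 ∷ a0 ∷ [])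
  ∷ (a1 ∷ a0 ∷ a2 ∷ a3 ∷ []) ∷ (a1 ∷ a0 ∷ a3 ∷ a1 ∷ []) ∷ (a2 ∷ a0 ∷ a1 ∷ a0 ∷ []) ∷ (a2 ∷ a0 ∷ a3 ∷ a0 ∷ [])
  ∷ (a2 ∷ a3 ∷ a0 ∷ a1 ∷ []) ∷ (a2 ∷ a3 ∷ a0 ∷ a2 ∷ []) ∷ (a3 ∷ a0 ∷ a1 ∷ a0 ∷ []) ∷ (a3 ∷ a0 ∷ a2 ∷ a0 ∷ [])
  ∷ (a3 ∷ a1 ∷ a0 ∷ a2 ∷ []) ∷ []

_≟ʷ_ : DecidableEquality (List Σ₄)
_≟ʷ_ = List.≡-dec Fin._≟_

open DecMembership _≟ʷ_ using (_∈?_)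

factors₄-closed : All (λ u → ∀ {r} → r < 7 → slice r 4 (image u) ∈ factors₄) factors₄
factors₄-closed = from-yes (all? (λ u → allUpTo? (λ r → slice r 4 (image u) ∈? factors₄) 7) factors₄)

synchronizing : All (λ u → All (λ v → ∀ {r} → r < 7 → ∀ {s} → s < 7 →
                  slice r 12 (image u) ≡ slice s 12 (image v) → r ≡ s) factors₄) factors₄
synchronizing = from-yes (all? (λ u → all? (λ v → allUpTo? (λ r → allUpTo? (λ s →
                  (slice r 12 (image u) ≟ʷ slice s 12 (image v)) →-dec (r ≟ s)) 7) 7) factors₄) factors₄)

short-squares-absent : All (λ u → ∀ {r} → r < 7 → ∀ {n} → n < 12 → 0 < n →
                         slice r n (image u) ≢ slice (r + n) n (image u)) factors₄
short-squares-absent = from-yes (all? (λ u → allUpTo? (λ r → allUpTo? (λ n →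
                         (0 <? n) →-dec ¬? (slice r n (image u) ≟ʷ slice (r + n) n (image u))) 12) 7) factors₄)

forbidden-absent : All (λ f → length f ≤ 22 × All (λ u → ∀ {r} → r < 7 → slice r (length f) (image u) ≢ f) factors₄)
                       forbidden
forbidden-absent = from-yes (all? (λ f → (length f ≤? 22) ×-dec
                     all? (λ u → allUpTo? (λ r → ¬? (slice r (length f) (image u) ≟ʷ f)) 7) factors₄) forbidden)

φ-column₃-injective : Injective _≡_ _≡_ (λ x → φ x (# 3))
φ-column₃-injective {x} {y} =
  from-yes (allFin? λ x → allFin? λ y → (φ x (# 3) Fin.≟ φ y (# 3)) →-dec (x Fin.≟ y)) x y

window : ℕ → List Σ₄
window q = factor word q 4

factor-word : ∀ i s L → s + L ≤ 22 → factor word (i + s) L ≡ slice (i % 7 + s) L (image (window (i / 7)))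
factor-word i s L s+L≤22 =
  trans (cong (λ p → factor word p L) split) (factor-fixedPoint (i / 7) (i % 7 + s) L 4 bound)
  where
  split : i + s ≡ i / 7 * 7 + (i % 7 + s)
  split = trans (cong (_+ s) (trans (m≡m%n+[m/n]*n i 7) (+-comm (i % 7) _))) (+-assoc _ (i % 7) s)
  bound : i % 7 + s + L ≤ 4 * 7
  bound = ≤-trans (≤-reflexive (+-assoc (i % 7) s L)) (+-mono-≤ (≤-pred (m%n<n i 7)) s+L≤22)

factor-word₀ : ∀ i L → L ≤ 22 → factor word i L ≡ slice (i % 7) L (image (window (i / 7)))
factor-word₀ i L L≤22 =
  trans (cong (λ p → factor word p L) (sym (+-identityʳ i)))
        (trans (factor-word i 0 L L≤22) (cong (λ r → slice r L (image (window (i / 7)))) (+-identityʳ (i % 7))))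

window∈factors₄ : ∀ q → window q ∈ factors₄
window∈factors₄ = <-rec (λ q → window q ∈ factors₄) step
  where
  step : ∀ q → (∀ {p} → p < q → window p ∈ factors₄) → window q ∈ factors₄
  step zero    _   = from-yes (window 0 ∈? factors₄)
  step (suc q) rec =
    subst (_∈ factors₄) (sym (factor-word₀ (suc q) 4 (m≤m+n 4 18)))
          (All.lookup factors₄-closed (rec (m/n<m (suc q) 7 (s≤s (s≤s z≤n)))) (m%n<n (suc q) 7))

short-square-free : ∀ i n → 0 < n → n < 12 → ¬ SquareAt word i n
short-square-free i n 0<n n<12 sq =
  All.lookup short-squares-absent (window∈factors₄ (i / 7)) (m%n<n i 7) n<12 0<n
    (trans (sym (factor-word₀ i n (≤-trans n≤11 (m≤m+n 11 11))))
           (trans (square-factor {w = word} {i} {n} sq n ≤-refl) (factor-word i n n (+-mono-≤ n≤11 n≤11))))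
  where
  n≤11 : n ≤ 11
  n≤11 = ≤-pred n<12

long-square-period : ∀ i n → 12 ≤ n → SquareAt word i n → 7 ∣ n
long-square-period i n 12≤n sq =
  m%d≡[m+n]%d⇒d∣n i n 7
    (All.lookup (All.lookup synchronizing (window∈factors₄ (i / 7))) (window∈factors₄ ((i + n) / 7))
                (m%n<n i 7) (m%n<n (i + n) 7)
                (trans (sym (factor-word₀ i 12 12≤22))
                       (trans (square-factor {w = word} {i} {n} sq 12 12≤n) (factor-word₀ (i + n) 12 12≤22))))
  where
  12≤22 : 12 ≤ 22
  12≤22 = m≤m+n 12 10

forbidden-free : (u : List Σ₄) → u ∈ forbidden → ¬ Occurs u word
forbidden-free u u∈forbidden (i , occ) =
  All.lookup absent (window∈factors₄ (i / 7)) {i % 7} (m%n<n i 7)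
    (trans (sym (factor-word₀ i (length u) length≤22)) (occurs-factor {w = word} {i} u occ))
  where
  length≤22 : length u ≤ 22
  length≤22 = proj₁ (All.lookup forbidden-absent u∈forbidden)
  absent : All (λ v → ∀ {r} → r < 7 → slice r (length u) (image v) ≢ u) factors₄
  absent = proj₂ (All.lookup forbidden-absent u∈forbidden)

theorem1 : ∃[ w ] (Squarefree {Σ₄} w × ((u : List Σ₄) → u ∈ forbidden → ¬ Occurs u w))
theorem1 = word , squarefree-by-descent (# 3) φ-column₃-injective 12 short-square-free long-square-period , forbidden-free
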